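{- Let $\phi$ be an $\mathsf{LTL}_f$ formula. Then $\phi$ is satisfiable if and only if there is a run $s_0\to s_1\to\cdots\to s_n$ ($n\ge 0$) of $T_\phi$ starting from the initial state $s_0=\{\phi\}$ such that (1) $s_n$ is a final state, and (2) for every $i$ with $0\le i\le n$ and every conflict sequence $\mathcal{C}$ of $T_\phi$ with $|\mathcal{C}|>n-i$, the state $s_i$ does not belong to $\mathcal{C}[n-i]$.
   Context: $\mathsf{LTL}_f$ is linear temporal logic interpreted over finite nonempty traces over a finite set $P$ of atoms; $\phi$ is satisfiable iff some finite nonempty trace satisfies it. $Tail$ denotes the formula that holds exactly at the last position of a trace. For a formula $\psi$, $\mathrm{xnf}(\psi)$ is its neXt normal form, an $\mathsf{LTL}_f$ formula equivalent to $\psi$ (possibly containing $Tail$) in which every temporal subformula occurs in the scope of a next operator $\mathsf{X}$; for a set $s$ of formulas, $\mathrm{xnf}(s)=\bigwedge_{\psi\in s}\mathrm{xnf}(\psi)$. For a formula $\theta$, $\theta^p$ is its propositional abstraction, obtained by treating each subformula of the form $\mathsf{X}\chi$ (and $Tail$) as a fresh Boolean variable. The transition system $T_\phi$ has as states finite sets of $\mathsf{LTL}_f$ formulas (each read as the conjunction of its elements), initial state $s_0=\{\phi\}$, and a transition $s\to s'$ whenever there is a satisfying assignment $A$ of $\mathrm{xnf}(s)^p$ with $s'=\{\chi : \text{the variable for } \mathsf{X}\chi \text{ is true in } A\}$; $s'$ is then a one-transition next state of $s$. A run is a sequence of states $s_0\to s_1\to\cdots\to s_n$ connected by transitions. A state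 $s$ is final iff $Tail\wedge \mathrm{xnf}(s)^p$ is satisfiable. It is a known property of $T_\phi$ that $\phi$ is satisfiable iff some run of $T_\phi$ from $s_0$ ends in a final state. A conflict sequence for $T_\phi$ is a finite nonempty sequence $\mathcal{C}[0],\ldots,\mathcal{C}[|\mathcal{C}|-1]$ of sets of states of $T_\phi$ such that: (1) $s_0\in\mathcal{C}[i]$ for all $0\le i<|\mathcal{C}|$; (2) no state in $\mathcal{C}[0]$ is final; (3) for every $0\le i<|\mathcal{C}|-1$ and every $s\in\mathcal{C}[i+1]$, all one-transition next states of $s$ belong to $\mathcal{C}[i]$. -}

module Defs where

open import Data.Nat using (ℕ; zero; suc; _≤_; _<_)
open import Data.Fin using (Fin)
open import Data.Bool using (Bool; true; false)
open import Data.List using (List; []; _∷_; _++_)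
open import Data.List.Membership.Propositional using (_∈_)
open import Data.Product using (Σ; ∃; _×_; _,_)
open import Data.Sum using (_⊎_)
open import Data.Unit using (⊤)
open import Data.Empty using (⊥)
open import Relation.Nullary using (¬_)
open import Relation.Binary.PropositionalEquality using (_≡_)
open import Function.Bundles using (_⇔_)

-- LTL_f syntax over the finite atom set P = Fin k, in negation normal
-- form (negation only on atoms), with strong next X, weak next N,
-- until U and release R.

data Form (k : ℕ) : Set where
  tt ff        : Form k
  atom natom   : Fin k → Form k
  _∧_ _∨_      : Form k → Form k → Form k
  X N          : Form k → Form k
  _U_ _R_      : Form k → Form k → Form k

-- Finite nonempty traces: positions 0 .. last, letter i ⊆ P
-- (values of letter beyond last are irrelevant).

record Trace (k : ℕ) : Set where
  field
    last   : ℕ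
    letter : ℕ → Fin k → Bool
open Trace public

-- satisfaction at position i (used for i ≤ last)
_,_⊨_ : ∀ {k} → Trace k → ℕ → Form k → Set
π , i ⊨ tt = ⊤
π , i ⊨ ff = ⊥
π , i ⊨ atom p = letter π i p ≡ true
π , i ⊨ natom p = letter π i p ≡ false
π , i ⊨ (φ ∧ ψ) = (π , i ⊨ φ) × (π , i ⊨ ψ)
π , i ⊨ (φ ∨ ψ) = (π , i ⊨ φ) ⊎ (π , i ⊨ ψ)
π , i ⊨ X φ = (i < last π) × (π , suc i ⊨ φ)
π , i ⊨ N φ = i < last π → π , suc i ⊨ φ
π , i ⊨ (φ U ψ) =
  ∃ λ j → (i ≤ j) × (j ≤ last π) × (π , j ⊨ ψ)
        × (∀ m → i ≤ m → m < j → π , m ⊨ φ)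
π , i ⊨ (φ R ψ) =
  ∀ j → i ≤ j → j ≤ last π →
    (π , j ⊨ ψ) ⊎ (∃ λ m → (i ≤ m) × (m < j) × (π , m ⊨ φ))

Satisfiable : ∀ {k} → Form k → Set
Satisfiable {k} φ = ∃ λ (π : Trace k) → π , 0 ⊨ φ

-- Reading X χ and
-- Tail as Boolean variables gives the propositional abstraction θ^p.

data XNF (k : ℕ) : Set where
  xtt xff      : XNF k
  xatom xnatom : Fin k → XNF k
  Tail         : XNF k
  X[_]         : Form k → XNF k
  _∧ₓ_ _∨ₓ_    : XNF k → XNF k → XNF k

xnf : ∀ {k} → Form k → XNF k
xnf tt = xtt
xnf ff = xff
xnf (atom p) = xatom p
xnf (natom p) = xnatom p
xnf (φ ∧ ψ) = xnf φ ∧ₓ xnf ψ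
xnf (φ ∨ ψ) = xnf φ ∨ₓ xnf ψ
xnf (X φ) = X[ φ ]
xnf (N φ) = Tail ∨ₓ X[ φ ]
xnf (φ U ψ) = xnf ψ ∨ₓ (xnf φ ∧ₓ X[ φ U ψ ])
xnf (φ R ψ) = xnf ψ ∧ₓ (Tail ∨ₓ (xnf φ ∨ₓ X[ φ R ψ ]))

-- states: finite sets of formulas, represented by lists
State : ℕ → Set
State k = List (Form k)

xnfˢ : ∀ {k} → State k → XNF k
xnfˢ [] = xtt
xnfˢ (ψ ∷ s) = xnf ψ ∧ₓ xnfˢ s

xvars : ∀ {k} → XNF k → List (Form k)
xvars X[ χ ] = χ ∷ []
xvars (θ ∧ₓ η) = xvars θ ++ xvars η
xvars (θ ∨ₓ η) = xvars θ ++ xvars η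
xvars _ = []

record Assignment (k : ℕ) : Set where
  field
    atomv : Fin k → Bool
    tailv : Bool
    nextv : Form k → Bool
open Assignment public

_⊨ᵖ_ : ∀ {k} → Assignment k → XNF k → Set
A ⊨ᵖ xtt = ⊤
A ⊨ᵖ xff = ⊥
A ⊨ᵖ xatom p = atomv A p ≡ true
A ⊨ᵖ xnatom p = atomv A p ≡ false
A ⊨ᵖ Tail = tailv A ≡ true
A ⊨ᵖ X[ χ ] = nextv A χ ≡ true
A ⊨ᵖ (θ ∧ₓ η) = (A ⊨ᵖ θ) × (A ⊨ᵖ η)
A ⊨ᵖ (θ ∨ₓ η) = (A ⊨ᵖ θ) ⊎ (A ⊨ᵖ η)

Next : ∀ {k} → State k → State k → Set
Next s s' = ∃ λ A → (A ⊨ᵖ xnfˢ s) × (tailv A ≡ false)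
  × (∀ χ → (χ ∈ s') ⇔ ((χ ∈ xvars (xnfˢ s)) × (nextv A χ ≡ true)))

-- final states (Tail ∧ xnf(s)^p satisfiable, with Tail forcing every
-- strong-next variable X χ to false)
Final : ∀ {k} → State k → Set
Final s = ∃ λ A → (A ⊨ᵖ xnfˢ s) × (tailv A ≡ true) × (∀ χ → nextv A χ ≡ false)

initial : ∀ {k} → Form k → State k
initial φ = φ ∷ []

record ConflictSeq {k : ℕ} (φ : Form k) : Set₁ where
  field
    len    : ℕ
    len>0  : 0 < len
    C      : ℕ → State k → Set
    init∈  : ∀ i → i < len → C i (initial φ)
    C0-nonfinal : ∀ s → C 0 s → ¬ Final s
    closed : ∀ i → suc i < len → ∀ s → C (suc i) s → ∀ s' → Next s s' → C i s'
open ConflictSeq public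

module Submission where

-- Everything rests on one semantic fact (xnf-correct): at a
-- position i ≤ last π of a trace π, a formula ψ holds iff its neXt normal
-- form xnf ψ is satisfied by the canonical assignment of π at i (atoms read
-- from the letter at i, Tail true iff i is the last position, X χ true iff
-- π , i ⊨ X χ).  This is the expansion law of N, U and R.
--
--  * Satisfiable ⇒ run.  Along a model π the states
--    run (i+1) = { χ ∈ vars (xnf (run i)) | π , i+1 ⊨ χ } contain only
--    formulas true at their position, so the canonical assignments witness
--    a run of T_φ of length last π ending in a final state.
--  * Run ⇒ Satisfiable.  The atoms of the assignments chosen along an
--    accepting run spell a trace.  XNF formulas are positive in their
--    next-variables, so by backward induction each chosen assignment is
--    dominated by the canonical one; hence every formula of s i holds at i.
--  * Conflict sequences.  A state reaching a final state in d transitions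
--    never lies in C[d] (induction on d using closure); the suffix of an
--    accepting run from s i reaches s n in n ∸ i transitions.

open import Defs
open import Data.Nat using (ℕ; zero; suc; _≤_; _<_; _∸_; _+_; z≤n; s≤s; _≟_; _≤?_; _<?_)
open import Data.Nat.Properties
  using ( ≤-refl; <⇒≤; <⇒≢; <-≤-trans; ≤⇒≯; <-irrefl; <-irrelevant
        ; m≤n⇒m<n∨m≡n; m<1+n⇒m≤n; m≤n+m; +-suc; +-identityʳ; m∸n+n≡m
        ; anyUpTo?; allUpTo? )
open import Data.Bool using (true; false) renaming (_≟_ to _≟ᵇ_)
open import Data.List using ([]; _∷_; filter)
open import Data.List.Membership.Propositional using (_∈_)
open import Data.List.Membership.Propositional.Properties
  using (∈-++⁺ˡ; ∈-++⁺ʳ; ∈-filter⁺; ∈-filter⁻)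
open import Data.List.Relation.Unary.All as All using (All; []; _∷_)
open import Data.List.Relation.Unary.Any using (here)
open import Data.Product using (∃; _×_; _,_; proj₁; proj₂)
open import Data.Product.Function.NonDependent.Propositional using (_×-⇔_)
open import Data.Sum using (_⊎_; inj₁; inj₂; [_,_]′)
open import Data.Sum.Function.Propositional using (_⊎-⇔_)
open import Relation.Nullary using (¬_; Dec; yes; no; does; contradiction)
open import Relation.Nullary.Decidable
  using (_×-dec_; _⊎-dec_; _→-dec_; map′; dec-true; dec-false)
open import Relation.Binary.PropositionalEquality
  using (_≡_; refl; sym; trans; subst; cong)
open import Function.Bundles using (_⇔_; mk⇔; Equivalence)
open import Function.Construct.Identity using (⇔-id)
open import Function.Construct.Symmetry using (⇔-sym)
open import Function.Construct.Composition using (_⇔-∘_)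
open Equivalence using (to; from)

module _ {P : ℕ → Set} (P? : ∀ m → Dec (P m)) where

  all-between? : ∀ i j → Dec (∀ m → i ≤ m → m < j → P m)
  all-between? i j =
    map′ (λ f m i≤m m<j → f m<j i≤m) (λ f {m} m<j i≤m → f m i≤m m<j)
      (allUpTo? (λ m → (i ≤? m) →-dec P? m) j)

  any-between? : ∀ i j → Dec (∃ λ m → i ≤ m × m < j × P m)
  any-between? i j =
    map′ (λ (m , m<j , i≤m , pm) → m , i≤m , m<j , pm)
         (λ (m , i≤m , m<j , pm) → m , m<j , i≤m , pm)
      (anyUpTo? (λ m → (i ≤? m) ×-dec P? m) j)

-- Satisfaction at a position is decidable; this lets the canonical
-- assignment and the run of a model be computed.
sat? : ∀ {k} (π : Trace k) i (ψ : Form k) → Dec (π , i ⊨ ψ)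
sat? π i tt = yes _
sat? π i ff = no λ ()
sat? π i (atom p) = letter π i p ≟ᵇ true
sat? π i (natom p) = letter π i p ≟ᵇ false
sat? π i (φ ∧ ψ) = sat? π i φ ×-dec sat? π i ψ
sat? π i (φ ∨ ψ) = sat? π i φ ⊎-dec sat? π i ψ
sat? π i (X φ) = (i <? last π) ×-dec sat? π (suc i) φ
sat? π i (N φ) = (i <? last π) →-dec sat? π (suc i) φ
sat? π i (φ U ψ) =
  map′ (λ (j , i≤j , j<1+l , ψj , φ-before) → j , i≤j , m<1+n⇒m≤n j<1+l , ψj , φ-before)
       (λ (j , i≤j , j≤l , ψj , φ-before) → j , i≤j , s≤s j≤l , ψj , φ-before)
    (any-between? (λ j → sat? π j ψ ×-dec all-between? (λ m → sat? π m φ) i j)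
                  i (suc (last π)))
sat? π i (φ R ψ) =
  map′ (λ f j i≤j j≤l → f j i≤j (s≤s j≤l)) (λ f j i≤j j<1+l → f j i≤j (m<1+n⇒m≤n j<1+l))
    (all-between? (λ j → sat? π j ψ ⊎-dec any-between? (λ m → sat? π m φ) i j)
                  i (suc (last π)))

does⇔ : ∀ {A : Set} (a? : Dec A) → (does a? ≡ true) ⇔ A
does⇔ (yes a) = mk⇔ (λ _ → a) (λ _ → refl)
does⇔ (no ¬a) = mk⇔ (λ ()) (λ a → contradiction a ¬a)

module _ {k} (π : Trace k) where

  N-expansion : ∀ {i} (φ : Form k) → i ≤ last π →
    (π , i ⊨ N φ) ⇔ ((i ≡ last π) ⊎ (π , i ⊨ X φ))
  N-expansion {i} φ i≤l = mk⇔ unfold fold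
    where
    unfold : π , i ⊨ N φ → (i ≡ last π) ⊎ (π , i ⊨ X φ)
    unfold h with m≤n⇒m<n∨m≡n i≤l
    ... | inj₁ i<l = inj₂ (i<l , h i<l)
    ... | inj₂ i≡l = inj₁ i≡l
    fold : (i ≡ last π) ⊎ (π , i ⊨ X φ) → π , i ⊨ N φ
    fold (inj₁ i≡l) i<l = contradiction i<l (<-irrefl i≡l)
    fold (inj₂ (_ , φ-next)) _ = φ-next

  U-expansion : ∀ {i} (φ ψ : Form k) → i ≤ last π →
    (π , i ⊨ (φ U ψ)) ⇔ ((π , i ⊨ ψ) ⊎ ((π , i ⊨ φ) × (π , i ⊨ X (φ U ψ))))
  U-expansion {i} φ ψ i≤l = mk⇔ unfold fold
    where
    unfold : π , i ⊨ (φ U ψ) → (π , i ⊨ ψ) ⊎ ((π , i ⊨ φ) × (π , i ⊨ X (φ U ψ)))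
    unfold (j , i≤j , j≤l , ψj , φ-before) with m≤n⇒m<n∨m≡n i≤j
    ... | inj₂ refl = inj₁ ψj
    ... | inj₁ i<j = inj₂ (φ-before i ≤-refl i<j , <-≤-trans i<j j≤l ,
                           j , i<j , j≤l , ψj , λ m i<m → φ-before m (<⇒≤ i<m))
    fold : (π , i ⊨ ψ) ⊎ ((π , i ⊨ φ) × (π , i ⊨ X (φ U ψ))) → π , i ⊨ (φ U ψ)
    fold (inj₁ ψi) = i , ≤-refl , i≤l , ψi , λ m i≤m m<i → contradiction m<i (≤⇒≯ i≤m)
    fold (inj₂ (φi , _ , j , i<j , j≤l , ψj , φ-after)) = j , <⇒≤ i<j , j≤l , ψj , φ-before
      where
      φ-before : ∀ m → i ≤ m → m < j → π , m ⊨ φ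
      φ-before m i≤m m<j with m≤n⇒m<n∨m≡n i≤m
      ... | inj₁ i<m = φ-after m i<m m<j
      ... | inj₂ refl = φi

  R-expansion : ∀ {i} (φ ψ : Form k) → i ≤ last π →
    (π , i ⊨ (φ R ψ)) ⇔
      ((π , i ⊨ ψ) × ((i ≡ last π) ⊎ ((π , i ⊨ φ) ⊎ (π , i ⊨ X (φ R ψ)))))
  R-expansion {i} φ ψ i≤l = mk⇔ unfold fold
    where
    now : π , i ⊨ (φ R ψ) → π , i ⊨ ψ
    now h with h i ≤-refl i≤l
    ... | inj₁ ψi = ψi
    ... | inj₂ (m , i≤m , m<i , _) = contradiction m<i (≤⇒≯ i≤m)
    later : π , i ⊨ (φ R ψ) → ¬ (π , i ⊨ φ) → π , suc i ⊨ (φ R ψ)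
    later h ¬φi j i<j j≤l with h j (<⇒≤ i<j) j≤l
    ... | inj₁ ψj = inj₁ ψj
    ... | inj₂ (m , i≤m , m<j , φm) with m≤n⇒m<n∨m≡n i≤m
    ...   | inj₁ i<m = inj₂ (m , i<m , m<j , φm)
    ...   | inj₂ refl = contradiction φm ¬φi
    unfold : π , i ⊨ (φ R ψ) →
      (π , i ⊨ ψ) × ((i ≡ last π) ⊎ ((π , i ⊨ φ) ⊎ (π , i ⊨ X (φ R ψ))))
    unfold h with m≤n⇒m<n∨m≡n i≤l | sat? π i φ
    ... | inj₂ i≡l | _      = now h , inj₁ i≡l
    ... | inj₁ i<l | yes φi = now h , inj₂ (inj₁ φi)
    ... | inj₁ i<l | no ¬φi = now h , inj₂ (inj₂ (i<l , later h ¬φi))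
    fold : (π , i ⊨ ψ) × ((i ≡ last π) ⊎ ((π , i ⊨ φ) ⊎ (π , i ⊨ X (φ R ψ)))) →
      π , i ⊨ (φ R ψ)
    fold (ψi , obligation) j i≤j j≤l with m≤n⇒m<n∨m≡n i≤j | obligation
    ... | inj₂ refl | _ = inj₁ ψi
    ... | inj₁ i<j | inj₁ i≡l = contradiction (<-≤-trans i<j j≤l) (<-irrefl i≡l)
    ... | inj₁ i<j | inj₂ (inj₁ φi) = inj₂ (i , ≤-refl , i<j , φi)
    ... | inj₁ i<j | inj₂ (inj₂ (_ , h)) =
      [ inj₁ , (λ (m , i<m , m<j , φm) → inj₂ (m , <⇒≤ i<m , m<j , φm)) ]′ (h j i<j j≤l)

canonical : ∀ {k} → Trace k → ℕ → Assignment k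
canonical π i = record
  { atomv = letter π i
  ; tailv = does (i ≟ last π)
  ; nextv = λ χ → does (sat? π i (X χ)) }

xnf-correct : ∀ {k} (π : Trace k) {i} → i ≤ last π →
  ∀ ψ → (π , i ⊨ ψ) ⇔ (canonical π i ⊨ᵖ xnf ψ)
xnf-correct π i≤l tt = ⇔-id _
xnf-correct π i≤l ff = ⇔-id _
xnf-correct π i≤l (atom p) = ⇔-id _
xnf-correct π i≤l (natom p) = ⇔-id _
xnf-correct π i≤l (φ ∧ ψ) = xnf-correct π i≤l φ ×-⇔ xnf-correct π i≤l ψ
xnf-correct π i≤l (φ ∨ ψ) = xnf-correct π i≤l φ ⊎-⇔ xnf-correct π i≤l ψ
xnf-correct π {i} i≤l (X φ) = ⇔-sym (does⇔ (sat? π i (X φ)))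
xnf-correct π {i} i≤l (N φ) =
  (⇔-sym (does⇔ (i ≟ last π)) ⊎-⇔ xnf-correct π i≤l (X φ))
    ⇔-∘ N-expansion π φ i≤l
xnf-correct π i≤l (φ U ψ) =
  (xnf-correct π i≤l ψ ⊎-⇔ (xnf-correct π i≤l φ ×-⇔ xnf-correct π i≤l (X (φ U ψ))))
    ⇔-∘ U-expansion π φ ψ i≤l
xnf-correct π {i} i≤l (φ R ψ) =
  (xnf-correct π i≤l ψ ×-⇔ (⇔-sym (does⇔ (i ≟ last π))
     ⊎-⇔ (xnf-correct π i≤l φ ⊎-⇔ xnf-correct π i≤l (X (φ R ψ)))))
    ⇔-∘ R-expansion π φ ψ i≤l

state-correct : ∀ {k} (π : Trace k) {i} → i ≤ last π →
  ∀ s → All (λ ψ → π , i ⊨ ψ) s ⇔ (canonical π i ⊨ᵖ xnfˢ s)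
state-correct π i≤l [] = mk⇔ (λ _ → _) (λ _ → [])
state-correct π i≤l (ψ ∷ s) =
  mk⇔ (λ { (h ∷ hs) → to (xnf-correct π i≤l ψ) h , to rest hs })
      (λ (a , as) → from (xnf-correct π i≤l ψ) a ∷ from rest as)
  where
  rest : All (λ ψ → π , _ ⊨ ψ) s ⇔ (canonical π _ ⊨ᵖ xnfˢ s)
  rest = state-correct π i≤l s

-- XNF formulas use their next-variables positively: if B agrees with A on
-- atoms and Tail and raises every next-variable of θ that A sets, then B
-- satisfies θ whenever A does.
⊨ᵖ-mono : ∀ {k} {A B : Assignment k} →
  (∀ p → atomv A p ≡ atomv B p) → tailv A ≡ tailv B →
  ∀ θ → (∀ χ → χ ∈ xvars θ → nextv A χ ≡ true → nextv B χ ≡ true) →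
  A ⊨ᵖ θ → B ⊨ᵖ θ
⊨ᵖ-mono atoms tail xtt raise h = h
⊨ᵖ-mono atoms tail (xatom p) raise h = trans (sym (atoms p)) h
⊨ᵖ-mono atoms tail (xnatom p) raise h = trans (sym (atoms p)) h
⊨ᵖ-mono atoms tail Tail raise h = trans (sym tail) h
⊨ᵖ-mono atoms tail X[ χ ] raise h = raise χ (here refl) h
⊨ᵖ-mono atoms tail (θ ∧ₓ η) raise (a , b) =
  ⊨ᵖ-mono atoms tail θ (λ χ m → raise χ (∈-++⁺ˡ m)) a ,
  ⊨ᵖ-mono atoms tail η (λ χ m → raise χ (∈-++⁺ʳ (xvars θ) m)) b
⊨ᵖ-mono atoms tail (θ ∨ₓ η) raise (inj₁ a) =
  inj₁ (⊨ᵖ-mono atoms tail θ (λ χ m → raise χ (∈-++⁺ˡ m)) a)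
⊨ᵖ-mono atoms tail (θ ∨ₓ η) raise (inj₂ b) =
  inj₂ (⊨ᵖ-mono atoms tail η (λ χ m → raise χ (∈-++⁺ʳ (xvars θ) m)) b)

data ReachesFinal {k} : ℕ → State k → Set where
  done : ∀ {s} → Final s → ReachesFinal 0 s
  step : ∀ {d s s'} → Next s s' → ReachesFinal d s' → ReachesFinal (suc d) s

-- C[d] contains no state that reaches a final state in d transitions:
-- C[0] has no final states and C[d+1] is closed under transitions into C[d].
reaches-final-avoids : ∀ {k} {φ : Form k} (𝒞 : ConflictSeq φ) {d s} →
  ReachesFinal d s → d < len 𝒞 → ¬ C 𝒞 d s
reaches-final-avoids 𝒞 (done final) _ s∈C = C0-nonfinal 𝒞 _ s∈C final
reaches-final-avoids 𝒞 {suc d} (step next reach) d+1<len s∈C =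
  reaches-final-avoids 𝒞 reach (<⇒≤ d+1<len) (closed 𝒞 d d+1<len _ s∈C _ next)

module RunOfModel {k} (π : Trace k) (φ : Form k) (model : π , 0 ⊨ φ) where

  run : ℕ → State k
  run zero = initial φ
  run (suc i) = filter (sat? π (suc i)) (xvars (xnfˢ (run i)))

  run-sound : ∀ i {ψ} → ψ ∈ run i → π , i ⊨ ψ
  run-sound zero (here refl) = model
  run-sound (suc i) ψ∈ =
    proj₂ (∈-filter⁻ (sat? π (suc i)) {xs = xvars (xnfˢ (run i))} ψ∈)

  canonical-sat : ∀ i → i ≤ last π → canonical π i ⊨ᵖ xnfˢ (run i)
  canonical-sat i i≤l = to (state-correct π i≤l (run i)) (All.tabulate (run-sound i))

  run-step : ∀ i → i < last π → Next (run i) (run (suc i))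
  run-step i i<l =
    canonical π i , canonical-sat i (<⇒≤ i<l) , dec-false (i ≟ last π) (<⇒≢ i<l) , successors
    where
    holds-next : ∀ χ → (π , suc i ⊨ χ) ⇔ (nextv (canonical π i) χ ≡ true)
    holds-next χ = ⇔-sym (does⇔ (sat? π i (X χ))) ⇔-∘ mk⇔ (i<l ,_) proj₂
    successors : ∀ χ → (χ ∈ run (suc i)) ⇔
      ((χ ∈ xvars (xnfˢ (run i))) × (nextv (canonical π i) χ ≡ true))
    successors χ =
      (⇔-id _ ×-⇔ holds-next χ)
        ⇔-∘ mk⇔ (∈-filter⁻ (sat? π (suc i)) {xs = xvars (xnfˢ (run i))})
                (λ (χ∈ , χ-holds) → ∈-filter⁺ (sat? π (suc i)) χ∈ χ-holds)

  run-final : Final (run (last π))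
  run-final =
    canonical π (last π) , canonical-sat (last π) ≤-refl ,
    dec-true (last π ≟ last π) refl ,
    λ χ → dec-false (sat? π (last π) (X χ)) (λ (l<l , _) → <-irrefl refl l<l)

module AcceptingRun {k} (n : ℕ) (s : ℕ → State k)
    (steps : ∀ i → i < n → Next (s i) (s (suc i))) (final : Final (s n)) where

  before-end : ∀ {d i} → suc d + i ≡ n → i < n
  before-end {d} {i} eq = subst (i <_) eq (s≤s (m≤n+m i d))

  suffix-reaches : ∀ d i → d + i ≡ n → ReachesFinal d (s i)
  suffix-reaches zero i refl = done final
  suffix-reaches (suc d) i eq =
    step (steps i (before-end eq)) (suffix-reaches d (suc i) (trans (+-suc d i) eq))

  avoids-conflicts : ∀ {φ : Form k} i → i ≤ n → ∀ (𝒞 : ConflictSeq φ) →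
    n ∸ i < len 𝒞 → ¬ C 𝒞 (n ∸ i) (s i)
  avoids-conflicts i i≤n 𝒞 =
    reaches-final-avoids 𝒞 (suffix-reaches (n ∸ i) i (m∸n+n≡m i≤n))

  chosen : ℕ → Assignment k
  chosen i with i <? n
  ... | yes i<n = proj₁ (steps i i<n)
  ... | no _ = proj₁ final

  chosen-step : ∀ i (i<n : i < n) → chosen i ≡ proj₁ (steps i i<n)
  chosen-step i i<n with i <? n
  ... | yes i<n' = cong (λ lt → proj₁ (steps i lt)) (<-irrelevant i<n' i<n)
  ... | no i≮n = contradiction i<n i≮n

  chosen-final : chosen n ≡ proj₁ final
  chosen-final with n <? n
  ... | yes n<n = contradiction n<n (<-irrefl refl)
  ... | no _ = refl

  trace : Trace k
  trace = record { last = n ; letter = λ i → atomv (chosen i) }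

  dominated : ∀ i A → chosen i ≡ A → tailv A ≡ does (i ≟ n) →
    (∀ χ → χ ∈ xvars (xnfˢ (s i)) → nextv A χ ≡ true →
       nextv (canonical trace i) χ ≡ true) →
    A ⊨ᵖ xnfˢ (s i) → canonical trace i ⊨ᵖ xnfˢ (s i)
  dominated i A chosen≡A tail =
    ⊨ᵖ-mono (λ p → cong (λ B → atomv B p) (sym chosen≡A)) tail (xnfˢ (s i))

  canonical-sat : ∀ d i → d + i ≡ n → canonical trace i ⊨ᵖ xnfˢ (s i)
  canonical-sat zero i refl =
    let (A , sat , tail-true , no-next) = final in
    dominated n A chosen-final (trans tail-true (sym (dec-true (n ≟ n) refl)))
      (λ χ _ χ-set → contradiction (trans (sym χ-set) (no-next χ)) λ ())
      sat
  canonical-sat (suc d) i eq =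
    let (A , sat , tail-false , successors) = steps i i<n in
    dominated i A (chosen-step i i<n) (trans tail-false (sym (dec-false (i ≟ n) (<⇒≢ i<n))))
      (λ χ χ∈ χ-set → successor-set χ (from (successors χ) (χ∈ , χ-set)))
      sat
    where
    i<n : i < n
    i<n = before-end eq
    -- by induction every member of s (i+1) holds at i+1, so its
    -- next-variable is canonically true at i
    successor-set : ∀ χ → χ ∈ s (suc i) → nextv (canonical trace i) χ ≡ true
    successor-set χ χ∈ =
      dec-true (sat? trace i (X χ))
        (i<n , All.lookup (from (state-correct trace i<n (s (suc i)))
                                (canonical-sat d (suc i) (trans (+-suc d i) eq))) χ∈)

  satisfiable : ∀ {φ} → s 0 ≡ initial φ → Satisfiable φ
  satisfiable {φ} s₀≡ =
    trace ,
    All.lookup (from (state-correct trace z≤n (s 0)) (canonical-sat n 0 (+-identityʳ n)))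
               (subst (φ ∈_) (sym s₀≡) (here refl))

mainTheorem2 : ∀ {k} (φ : Form k) →
    Satisfiable φ ⇔
      (∃ λ (n : ℕ) → ∃ λ (s : ℕ → State k) →
          (s 0 ≡ initial φ)
        × (∀ i → i < n → Next (s i) (s (suc i)))
        × Final (s n)
        × (∀ i → i ≤ n → ∀ (𝒞 : ConflictSeq φ) → n ∸ i < len 𝒞 →
             ¬ C 𝒞 (n ∸ i) (s i)))
mainTheorem2 φ = mk⇔
  (λ (π , model) → let open RunOfModel π φ model in
     last π , run , refl , run-step , run-final ,
     AcceptingRun.avoids-conflicts (last π) run run-step run-final)
  (λ (n , s , s₀≡ , steps , final , _) →
     AcceptingRun.satisfiable n s steps final s₀≡)
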